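{- Let $\mathcal X$ be a circulant scheme over a finite cyclic group $G$, let $\mathfrak S\in\mathrm{Sec}_1(\mathcal X)$ and $\mathfrak s\in\mathfrak S$, and let $x$ be a tuple of elements of $G$ with $1_G\in\Omega(x)$. Then (1) $\{\mathfrak s\}$ is a fiber of $\mathcal X_{x,\mathfrak S}$ if and only if $\mathfrak s$ (regarded as a subset of $G$) is a union of fibers of $\mathcal X_x$; (2) if $\mathfrak T\in\mathrm{Sec}_1(\mathcal X)$ and $\mathfrak S\sim\mathfrak T$, then $\{\mathfrak s\}$ is a fiber of $\mathcal X_{x,\mathfrak S}$ if and only if $\{f_{\mathfrak S,\mathfrak T}(\mathfrak s)\}$ is a fiber of $\mathcal X_{x,\mathfrak T}$.
   Context: A coherent configuration on a finite set $\Omega$ is $(\Omega,S)$ with $S$ a partition of $\Omega\times\Omega$ (basis relations) such that $1_\Omega$ is a union of basis relations, $S$ is closed under transposition, and $|\{\gamma:(\alpha,\gamma)\in r,(\gamma,\beta)\in s\}|$ is independent of $(\alpha,\beta)\in t$ for $r,s,t\in S$. A fiber is a set $\Delta$ with $1_\Delta=\{(\delta,\delta):\delta\in\Delta\}\in S$. $\mathcal X\le\mathcal Y$ if every basis relation of $\mathcal X$ is a union of basis relations of $\mathcal Y$. For a tuple $x=(x_1,\dots,x_k)$, $\Omega(x)=\{x_1,\dots,x_k\}$ and the point extension $\mathcal X_x$ is the smallest coherent configuration $\mathcal Y\ge\mathcal X$ in which every $\{x_i\}$ is a fiber. A circulant scheme over a cyclic group $G$ is a coherent configuration $(G,S)$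 with $(\alpha,\beta)\in s\Rightarrow(\alpha g,\beta g)\in s$. For $H\le G$, $e(H)$ is the coset partition; $H$ is an $\mathcal X$-group if $e(H)$ is a union of basis relations. For $\mathcal X$-groups $L\le U$, $\mathfrak S=U/L$ is a section (its elements are cosets of $L$, viewed both as group elements of $U/L$ and as subsets of $G$); $\mathrm{Sec}_1(\mathcal X)$ is the set of these, with $U(\mathfrak S)=U$, $L(\mathfrak S)=L$. For a coherent configuration $\mathcal Y=(G,S_{\mathcal Y})\ge\mathcal X$ (in particular $\mathcal Y=\mathcal X_x$), $\mathcal Y_{\mathfrak S}$ denotes the coherent configuration on $\mathfrak S$ whose basis relations are the nonempty relations $s_{\mathfrak S}=\{(\Gamma,\Gamma')\in\mathfrak S^2:s\cap(\Gamma\times\Gamma')\ne\varnothing\}$, $s\in S_{\mathcal Y}$, $s\subseteq U\times U$; and $\mathcal X_{x,\mathfrak S}:=(\mathcal X_x)_{\mathfrak S}$. $\mathfrak S$ is a multiple of $\mathfrak T$ if $L(\mathfrak T)=U(\mathfrak T)\cap L(\mathfrak S)$ and $U(\mathfrak S)=U(\mathfrak T)L(\mathfrak S)$; then $f_{\mathfrak T,\mathfrak S}:\mathfrak T\to\mathfrak S$, $L(\mathfrak T)g\mapsto L(\mathfrak S)g$ ($g\in U(\mathfrak T)$), is a group isomorphism and $f_{\mathfrak S,\mathfrak T}=f_{\mathfrak T,\mathfrak S}^{ -1}$. Projective equivalence $\sim$ is the equivalence relation generated by "is a multiple of"; for $\mathfrak S\sim\mathfrak T$, $f_{\mathfrak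 S,\mathfrak T}$ is the composition of such maps (or their inverses) along a chain of sections connecting $\mathfrak S$ to $\mathfrak T$ in which consecutive sections are multiples of one another. -}

module Defs where

open import Level using (0ℓ)
open import Data.Nat using (ℕ; zero; suc; _+_; _∸_; _≟_)
open import Data.Nat.DivMod using (_mod_)
open import Data.Fin using (Fin; toℕ)
open import Data.Bool using (Bool; true; false; _∧_)
open import Data.Product using (Σ; _×_; _,_)
open import Data.List using (List)
open import Data.List.Relation.Unary.All using (All)
open import Relation.Nullary.Decidable using (⌊_⌋)
open import Relation.Binary.PropositionalEquality using (_≡_)
open import Function using (_⇔_)

-- The cyclic group G = ℤ / (suc m) ℤ, written additively
-- (identity 1_G is written 𝟘, product αβ is written α ⊕ β).

G : ℕ → Set
G m = Fin (suc m)

𝟘 : ∀ {m} → G m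
𝟘 = Fin.zero

_⊕_ : ∀ {m} → G m → G m → G m
_⊕_ {m} a b = (toℕ a + toℕ b) mod (suc m)

⊖_ : ∀ {m} → G m → G m
⊖_ {m} a = (suc m ∸ toℕ a) mod (suc m)

_⊖_ : ∀ {m} → G m → G m → G m
a ⊖ b = a ⊕ (⊖ b)

Subset : ℕ → Set₁
Subset m = G m → Set

IsSubgroup : ∀ {m} → Subset m → Set
IsSubgroup {m} H =
  H 𝟘 × (∀ (a b : G m) → H a → H b → H (a ⊕ b)) × (∀ (a : G m) → H a → H (⊖ a))

-- Partitions of G × G are given by colourings: the basis relations are
-- the (nonempty) colour classes { (c , d) | col c d ≡ col a b }.

Coloring : ℕ → Set
Coloring m = G m → G m → ℕ

IsUnionOfBasis : ∀ {m} → Coloring m → (G m → G m → Set) → Set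
IsUnionOfBasis {m} col r =
  ∀ (a b c d : G m) → col a b ≡ col c d → r a b → r c d

count : ∀ {k} → (Fin k → Bool) → ℕ
count {zero} p = 0
count {suc k} p with p Fin.zero
... | true  = suc (count {k} (λ i → p (Fin.suc i)))
... | false = count {k} (λ i → p (Fin.suc i))

interNum : ∀ {m} → Coloring m → ℕ → ℕ → G m → G m → ℕ
interNum col r s a b = count (λ γ → ⌊ col a γ ≟ r ⌋ ∧ ⌊ col γ b ≟ s ⌋)

record IsCoherentConfiguration {m} (col : Coloring m) : Set where
  field
    diagonal  : IsUnionOfBasis col (λ a b → a ≡ b)
    transpose : ∀ (a b c d : G m) → col a b ≡ col c d → col b a ≡ col d c
    intersection : ∀ (r s : ℕ) (a b c d : G m) → col a b ≡ col c d →
                   interNum col r s a b ≡ interNum col r s c d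

record IsCirculantScheme {m} (col : Coloring m) : Set where
  field
    coherent  : IsCoherentConfiguration col
    invariant : ∀ (a b g : G m) → col (a ⊕ g) (b ⊕ g) ≡ col a b

_≤CC_ : ∀ {m} → Coloring m → Coloring m → Set
_≤CC_ {m} X Y = ∀ (a b : G m) → IsUnionOfBasis Y (λ c d → X c d ≡ X a b)

IsFiber : ∀ {m} → Coloring m → Subset m → Set
IsFiber {m} Y Δ = Σ (G m) λ a → Σ (G m) λ b →
  ∀ (c d : G m) → (Y c d ≡ Y a b) ⇔ (c ≡ d × Δ c)

IsUnionOfFibers : ∀ {m} → Coloring m → Subset m → Set₁
IsUnionOfFibers {m} Y Δ = ∀ (δ : G m) → Δ δ →
  Σ (Subset m) λ Φ → IsFiber Y Φ × Φ δ × (∀ (γ : G m) → Φ γ → Δ γ)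

IsPointExtension : ∀ {m} → Coloring m → List (G m) → Coloring m → Set
IsPointExtension {m} X x Y =
  IsCoherentConfiguration Y × X ≤CC Y ×
  All (λ xi → IsFiber Y (λ g → g ≡ xi)) x ×
  (∀ (Z : Coloring m) → IsCoherentConfiguration Z → X ≤CC Z →
     All (λ xi → IsFiber Z (λ g → g ≡ xi)) x → Y ≤CC Z)

-- e(H) (the relation "same coset of H") is a union of basis relations of X
IsXGroup : ∀ {m} → Coloring m → Subset m → Set
IsXGroup X H = IsSubgroup H × IsUnionOfBasis X (λ a b → H (b ⊖ a))

record Section {m} (X : Coloring m) : Set₁ where
  field
    U L     : Subset m
    U-group : IsXGroup X U
    L-group : IsXGroup X L
    L⊆U     : ∀ (g : G m) → L g → U g
open Section public

-- The element L g of U / L, regarded as a subset of G (the coset L g).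
Coset : ∀ {m} {X : Coloring m} → Section X → G m → Subset m
Coset 𝔖 g h = L 𝔖 (h ⊖ g)

-- { L g } is a fiber of Y_𝔖 (for g ∈ U(𝔖)): there is a basis relation s of Y
-- with s ⊆ U × U and s_𝔖 = { (L g , L g) }.
IsQuotientFiber : ∀ {m} {X : Coloring m} → Coloring m → Section X → G m → Set
IsQuotientFiber {m} Y 𝔖 g = Σ (G m) λ a → Σ (G m) λ b →
  (∀ (c d : G m) → Y c d ≡ Y a b → U 𝔖 c × U 𝔖 d) ×
  (∀ (h h' : G m) → U 𝔖 h → U 𝔖 h' →
     (Σ (G m) λ c → Σ (G m) λ d → Coset 𝔖 h c × Coset 𝔖 h' d × Y c d ≡ Y a b)
     ⇔ (L 𝔖 (h ⊖ g) × L 𝔖 (h' ⊖ g)))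

IsMultipleOf : ∀ {m} {X : Coloring m} → Section X → Section X → Set
IsMultipleOf {m} 𝔖 𝔗 =
  (∀ (g : G m) → L 𝔗 g ⇔ (U 𝔗 g × L 𝔖 g)) ×
  (∀ (g : G m) → U 𝔖 g ⇔ (Σ (G m) λ a → Σ (G m) λ b → U 𝔗 a × L 𝔖 b × g ≡ a ⊕ b))

-- A chain of sections from 𝔖 to 𝔗, consecutive ones being multiples of
-- one another (in either direction); its existence is 𝔖 ∼ 𝔗.
data Chain {m} {X : Coloring m} (𝔖 : Section X) : Section X → Set₁ where
  []    : Chain 𝔖 𝔖
  -- last step 𝔗 → 𝔘 where 𝔘 is a multiple of 𝔗 (map f_{𝔗,𝔘})
  _▸up_ : ∀ {𝔗 𝔘} → Chain 𝔖 𝔗 → IsMultipleOf 𝔘 𝔗 → Chain 𝔖 𝔘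
  -- last step 𝔗 → 𝔘 where 𝔗 is a multiple of 𝔘 (map f_{𝔗,𝔘} = f_{𝔘,𝔗}⁻¹)
  _▸down_ : ∀ {𝔗 𝔘} → Chain 𝔖 𝔗 → IsMultipleOf 𝔗 𝔘 → Chain 𝔖 𝔘

-- Graph of f_{𝔗,𝔘} for 𝔘 a multiple of 𝔗, on representatives:
-- f(L(𝔗) k) = L(𝔘) h  iff  (k ∈ U(𝔗) and) L(𝔘) h = L(𝔘) k.
MultGraph : ∀ {m} {X : Coloring m} → Section X → Section X → G m → G m → Set
MultGraph 𝔗 𝔘 k h = U 𝔗 k × U 𝔘 h × L 𝔘 (h ⊖ k)

-- Graph of the composite map f_{𝔖,𝔗} along a chain, on representatives:
-- ChainGraph c g h  iff  f_{𝔖,𝔗}(L(𝔖) g) = L(𝔗) h.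
ChainGraph : ∀ {m} {X : Coloring m} {𝔖 𝔗 : Section X} →
             Chain 𝔖 𝔗 → G m → G m → Set
ChainGraph {𝔖 = 𝔖} [] g h = U 𝔖 g × U 𝔖 h × L 𝔖 (h ⊖ g)
ChainGraph {m} (_▸up_ {𝔗} {𝔘} c _) g h =
  Σ (G m) λ k → ChainGraph c g k × MultGraph 𝔗 𝔘 k h
ChainGraph {m} (_▸down_ {𝔗} {𝔘} c _) g h =
  Σ (G m) λ k → ChainGraph c g k × MultGraph 𝔘 𝔗 h k

module Submission where

-- The whole lemma reduces to one condition on g: the fiber of Y through g lies in the coset
-- L g. Since X ≤ Y and {𝟘} is a fiber of Y, every X-group is a union of Y-fibers and Y-colours
-- respect its cosets; with the path lifting that coherence provides, the condition depends only
-- on the coset L g and is equivalent both to L g being a union of Y-fibers and to {L g} being a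
-- fiber of Y_𝔖, which gives (1). If 𝔘 is a multiple of 𝔗 then L(𝔗) = U(𝔗) ∩ L(𝔘), and the
-- fiber through k ∈ U(𝔗) stays in U(𝔗), so the conditions for 𝔗 and 𝔘 at k agree; (2) follows
-- by induction along the chain.

open import Level using (0ℓ)
open import Algebra.Bundles using (AbelianGroup)
open import Algebra.Consequences.Propositional using (comm∧idʳ⇒id; comm∧invʳ⇒inv)
import Algebra.Properties.Group as GroupProperties
open import Data.Bool using (Bool; true; false; T; _∧_)
open import Data.Bool.Properties using (T-∧)
open import Data.Empty using (⊥-elim)
open import Data.Fin using (Fin; toℕ)
open import Data.Fin.Properties using (toℕ-injective; toℕ<n; toℕ-fromℕ<)
open import Data.List using (List)
open import Data.List.Membership.Propositional using (_∈_)
import Data.List.Relation.Unary.All as All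
open import Data.Nat using (ℕ; suc; _+_; _∸_; _<_; _≟_; s≤s; z≤n)
open import Data.Nat.DivMod using (_%_; %-distribˡ-+; m%n%n≡m%n; m<n⇒m%n≡m; n%n≡0)
open import Data.Nat.Properties using (+-comm; +-assoc; +-identityʳ; m+[n∸m]≡n; <⇒≤)
open import Data.Product using (Σ; ∃; _×_; _,_; proj₁; proj₂)
open import Function using (_⇔_; mk⇔; Equivalence)
import Function.Properties.Equivalence as ⇔
open import Relation.Nullary.Decidable using (⌊_⌋; toWitness; fromWitness)
open import Relation.Binary.PropositionalEquality
  using (_≡_; refl; sym; trans; cong; cong₂; subst; isEquivalence; module ≡-Reasoning)

open import Defs

open Equivalence

module _ {m : ℕ} where
  private
    n = suc m

  [m+n%d]%d≡[m+n]%d : ∀ a b → (a + b % n) % n ≡ (a + b) % n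
  [m+n%d]%d≡[m+n]%d a b = begin
    (a + b % n) % n          ≡⟨ %-distribˡ-+ a (b % n) n ⟩
    (a % n + b % n % n) % n  ≡⟨ cong (λ t → (a % n + t) % n) (m%n%n≡m%n b n) ⟩
    (a % n + b % n) % n      ≡⟨ %-distribˡ-+ a b n ⟨
    (a + b) % n              ∎
    where open ≡-Reasoning

  [m%d+n]%d≡[m+n]%d : ∀ a b → (a % n + b) % n ≡ (a + b) % n
  [m%d+n]%d≡[m+n]%d a b = begin
    (a % n + b) % n  ≡⟨ cong (_% n) (+-comm (a % n) b) ⟩
    (b + a % n) % n  ≡⟨ [m+n%d]%d≡[m+n]%d b a ⟩
    (b + a) % n      ≡⟨ cong (_% n) (+-comm b a) ⟩
    (a + b) % n      ∎
    where open ≡-Reasoning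

  toℕ-⊕ : ∀ (a b : G m) → toℕ (a ⊕ b) ≡ (toℕ a + toℕ b) % n
  toℕ-⊕ a b = toℕ-fromℕ< _

  ⊕-comm : ∀ (a b : G m) → a ⊕ b ≡ b ⊕ a
  ⊕-comm a b = toℕ-injective (begin
    toℕ (a ⊕ b)          ≡⟨ toℕ-⊕ a b ⟩
    (toℕ a + toℕ b) % n  ≡⟨ cong (_% n) (+-comm (toℕ a) (toℕ b)) ⟩
    (toℕ b + toℕ a) % n  ≡⟨ toℕ-⊕ b a ⟨
    toℕ (b ⊕ a)          ∎)
    where open ≡-Reasoning

  ⊕-assoc : ∀ (a b c : G m) → (a ⊕ b) ⊕ c ≡ a ⊕ (b ⊕ c)
  ⊕-assoc a b c = toℕ-injective (begin
    toℕ ((a ⊕ b) ⊕ c)                    ≡⟨ toℕ-⊕ (a ⊕ b) c ⟩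
    (toℕ (a ⊕ b) + toℕ c) % n            ≡⟨ cong (λ t → (t + toℕ c) % n) (toℕ-⊕ a b) ⟩
    ((toℕ a + toℕ b) % n + toℕ c) % n    ≡⟨ [m%d+n]%d≡[m+n]%d (toℕ a + toℕ b) (toℕ c) ⟩
    (toℕ a + toℕ b + toℕ c) % n          ≡⟨ cong (_% n) (+-assoc (toℕ a) (toℕ b) (toℕ c)) ⟩
    (toℕ a + (toℕ b + toℕ c)) % n        ≡⟨ [m+n%d]%d≡[m+n]%d (toℕ a) (toℕ b + toℕ c) ⟨
    (toℕ a + (toℕ b + toℕ c) % n) % n    ≡⟨ cong (λ t → (toℕ a + t) % n) (toℕ-⊕ b c) ⟨
    (toℕ a + toℕ (b ⊕ c)) % n            ≡⟨ toℕ-⊕ a (b ⊕ c) ⟨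
    toℕ (a ⊕ (b ⊕ c))                    ∎)
    where open ≡-Reasoning

  ⊕-identityʳ : ∀ (a : G m) → a ⊕ 𝟘 ≡ a
  ⊕-identityʳ a = toℕ-injective (begin
    toℕ (a ⊕ 𝟘)      ≡⟨ toℕ-⊕ a 𝟘 ⟩
    (toℕ a + 0) % n  ≡⟨ cong (_% n) (+-identityʳ (toℕ a)) ⟩
    toℕ a % n        ≡⟨ m<n⇒m%n≡m (toℕ<n a) ⟩
    toℕ a            ∎)
    where open ≡-Reasoning

  ⊕-inverseʳ : ∀ (a : G m) → a ⊕ (⊖ a) ≡ 𝟘
  ⊕-inverseʳ a = toℕ-injective (begin
    toℕ (a ⊕ (⊖ a))                  ≡⟨ toℕ-⊕ a (⊖ a) ⟩
    (toℕ a + toℕ (⊖ a)) % n          ≡⟨ cong (λ t → (toℕ a + t) % n) (toℕ-fromℕ< _) ⟩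
    (toℕ a + (n ∸ toℕ a) % n) % n    ≡⟨ [m+n%d]%d≡[m+n]%d (toℕ a) (n ∸ toℕ a) ⟩
    (toℕ a + (n ∸ toℕ a)) % n        ≡⟨ cong (_% n) (m+[n∸m]≡n (<⇒≤ (toℕ<n a))) ⟩
    n % n                            ≡⟨ n%n≡0 n ⟩
    0                                ∎)
    where open ≡-Reasoning

cyclicGroup : ℕ → AbelianGroup 0ℓ 0ℓ
cyclicGroup m = record
  { Carrier = G m
  ; _≈_ = _≡_
  ; _∙_ = _⊕_
  ; ε = 𝟘
  ; _⁻¹ = ⊖_
  ; isAbelianGroup = record
    { isGroup = record
      { isMonoid = record
        { isSemigroup = record
          { isMagma = record { isEquivalence = isEquivalence ; ∙-cong = cong₂ _⊕_ }
          ; assoc = ⊕-assoc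
          }
        ; identity = comm∧idʳ⇒id ⊕-comm ⊕-identityʳ
        }
      ; inverse = comm∧invʳ⇒inv ⊕-comm ⊕-inverseʳ
      ; ⁻¹-cong = cong (λ a → ⊖ a)
      }
    ; comm = ⊕-comm
    }
  }

module _ {m : ℕ} where
  open AbelianGroup (cyclicGroup m) using (assoc; inverseʳ; group)
  open GroupProperties group using (\\-leftDividesʳ; //-rightDividesˡ; ⁻¹-anti-homo-//)

  ⊖-trans : ∀ (a b c : G m) → (a ⊖ b) ⊕ (b ⊖ c) ≡ a ⊖ c
  ⊖-trans a b c = begin
    (a ⊖ b) ⊕ (b ⊖ c)      ≡⟨ assoc a (⊖ b) (b ⊖ c) ⟩
    a ⊕ ((⊖ b) ⊕ (b ⊖ c))  ≡⟨ cong (a ⊕_) (\\-leftDividesʳ b (⊖ c)) ⟩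
    a ⊖ c                  ∎
    where open ≡-Reasoning

  module Cosets {H : Subset m} (H-subgroup : IsSubgroup H) where
    private
      H𝟘 = proj₁ H-subgroup
      H⊕ = proj₁ (proj₂ H-subgroup)
      H⊖ = proj₂ (proj₂ H-subgroup)

    coset-refl : ∀ a → H (a ⊖ a)
    coset-refl a = subst H (sym (inverseʳ a)) H𝟘

    coset-sym : ∀ a b → H (a ⊖ b) → H (b ⊖ a)
    coset-sym a b p = subst H (⁻¹-anti-homo-// a b) (H⊖ _ p)

    coset-trans : ∀ a b c → H (a ⊖ b) → H (b ⊖ c) → H (a ⊖ c)
    coset-trans a b c p q = subst H (⊖-trans a b c) (H⊕ _ _ p q)

    ⊖-closed : ∀ a b → H a → H b → H (a ⊖ b)
    ⊖-closed a b p q = H⊕ a (⊖ b) p (H⊖ b q)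

    coset-closed : ∀ a b → H (a ⊖ b) → H b → H a
    coset-closed a b p q = subst H (//-rightDividesˡ b a) (H⊕ _ _ p q)

count-positive : ∀ {k} (p : Fin k → Bool) (i : Fin k) → T (p i) → 0 < count p
count-positive {suc k} p Fin.zero t with p Fin.zero
... | true  = s≤s z≤n
... | false = ⊥-elim t
count-positive {suc k} p (Fin.suc i) t with p Fin.zero
... | true  = s≤s z≤n
... | false = count-positive (λ j → p (Fin.suc j)) i t

count-witness : ∀ {k} (p : Fin k → Bool) → 0 < count p → ∃ λ i → T (p i)
count-witness {suc k} p pos with p Fin.zero in eq
... | true  = Fin.zero , subst T (sym eq) _
... | false with count-witness (λ j → p (Fin.suc j)) pos
...   | i , t = Fin.suc i , t

module _ {m : ℕ} (col : Coloring m) where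

  private
    Between : ℕ → ℕ → G m → G m → G m → Bool
    Between r s a b γ = ⌊ col a γ ≟ r ⌋ ∧ ⌊ col γ b ≟ s ⌋

    T-Between : ∀ {r s a b γ} → T (Between r s a b γ) ⇔ (col a γ ≡ r × col γ b ≡ s)
    T-Between {r} {s} {a} {b} {γ} = mk⇔
      (λ t → toWitness (proj₁ (to T-∧′ t)) , toWitness (proj₂ (to T-∧′ t)))
      (λ (e₁ , e₂) → from T-∧′ (fromWitness e₁ , fromWitness e₂))
      where T-∧′ = T-∧ {⌊ col a γ ≟ r ⌋} {⌊ col γ b ≟ s ⌋}

  interNum-positive : ∀ {a b} γ → 0 < interNum col (col a γ) (col γ b) a b
  interNum-positive {a} {b} γ =
    count-positive (Between (col a γ) (col γ b) a b) γ (from T-Between (refl , refl))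

  interNum-witness : ∀ {r s a b} → 0 < interNum col r s a b →
                     ∃ λ γ → col a γ ≡ r × col γ b ≡ s
  interNum-witness {r} {s} {a} {b} pos with count-witness (Between r s a b) pos
  ... | γ , t = γ , to T-Between t

≤CC⇒coarser : ∀ {m} {X Y : Coloring m} → X ≤CC Y →
              ∀ {a b c d} → Y a b ≡ Y c d → X a b ≡ X c d
≤CC⇒coarser X≤Y {a} {b} {c} {d} e = sym (X≤Y a b a b c d e refl)

fiber-member : ∀ {m} {Y : Coloring m} {Φ : Subset m} → IsFiber Y Φ →
               ∀ {δ γ} → Φ δ → Y γ γ ≡ Y δ δ → Φ γ
fiber-member (_ , _ , Φ-fiber) {δ} {γ} δ∈Φ e =
  proj₂ (to (Φ-fiber γ γ) (trans e (from (Φ-fiber δ δ) (refl , δ∈Φ))))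

module CoherentConfiguration {m : ℕ} {Y : Coloring m} (Y-cc : IsCoherentConfiguration Y) where
  open IsCoherentConfiguration Y-cc

  path-lift : ∀ {p q p′ q′} → Y p q ≡ Y p′ q′ →
              ∀ r → ∃ λ r′ → Y p′ r′ ≡ Y p r × Y r′ q′ ≡ Y r q
  path-lift {p} {q} {p′} {q′} e r = interNum-witness Y
    (subst (0 <_) (intersection (Y p r) (Y r q) p q p′ q′ e) (interNum-positive Y r))

  diagonal-colour : ∀ {a c d} → Y c d ≡ Y a a → c ≡ d
  diagonal-colour {a} {c} {d} e = diagonal a a c d (sym e) refl

  source-fiber : ∀ {a b c d} → Y c d ≡ Y a b → Y c c ≡ Y a a
  source-fiber {a} e with path-lift (sym e) a
  ... | z , Ycz≡Yaa , _ with diagonal-colour Ycz≡Yaa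
  ...   | refl = Ycz≡Yaa

  FiberOf : G m → Subset m
  FiberOf k ε = Y ε ε ≡ Y k k

  fiberOf-isFiber : ∀ k → IsFiber Y (FiberOf k)
  fiberOf-isFiber k = k , k , λ c d → mk⇔ (fwd c d) (bwd c d)
    where
    fwd : ∀ c d → Y c d ≡ Y k k → c ≡ d × FiberOf k c
    fwd c d e with diagonal-colour e
    ... | refl = refl , e
    bwd : ∀ c d → c ≡ d × FiberOf k c → Y c d ≡ Y k k
    bwd c .c (refl , e) = e

  FiberClosed : Subset m → Set
  FiberClosed Δ = ∀ δ γ → Δ δ → FiberOf δ γ → Δ γ

  unionOfFibers⇔fiberClosed : ∀ {Δ} → IsUnionOfFibers Y Δ ⇔ FiberClosed Δ
  unionOfFibers⇔fiberClosed {Δ} = mk⇔ closed union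
    where
    closed : IsUnionOfFibers Y Δ → FiberClosed Δ
    closed Δ-union δ γ δ∈Δ γ∼δ with Δ-union δ δ∈Δ
    ... | Φ , Φ-fiber , δ∈Φ , Φ⊆Δ = Φ⊆Δ γ (fiber-member Φ-fiber δ∈Φ γ∼δ)
    union : FiberClosed Δ → IsUnionOfFibers Y Δ
    union Δ-closed δ δ∈Δ = FiberOf δ , fiberOf-isFiber δ , refl , λ γ → Δ-closed δ γ δ∈Δ

module PointExtension {m : ℕ} {X Y : Coloring m} (Y-cc : IsCoherentConfiguration Y)
                      (X≤Y : X ≤CC Y) (𝟘-fiber : IsFiber Y (λ g → g ≡ 𝟘)) where
  open CoherentConfiguration Y-cc

  xgroup-respects : ∀ {H} → IsXGroup X H →
                    ∀ {a b c d} → Y a b ≡ Y c d → H (b ⊖ a) → H (d ⊖ c)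
  xgroup-respects H-xgroup {a} {b} {c} {d} e = proj₂ H-xgroup a b c d (≤CC⇒coarser X≤Y e)

  -- Since {𝟘} is a fiber, lifting the pair (𝟘, k) along Y k k ≡ Y ε ε gives Y 𝟘 ε ≡ Y 𝟘 k.
  xgroup-fiberClosed : ∀ {H} → IsXGroup X H → FiberClosed H
  xgroup-fiberClosed H-xgroup k ε k∈H ε∼k with path-lift (sym ε∼k) 𝟘
  ... | r , _ , Yrε≡Y𝟘k with fiber-member 𝟘-fiber refl (source-fiber Yrε≡Y𝟘k)
  ...   | refl =
    coset-closed ε 𝟘 (xgroup-respects H-xgroup (sym Yrε≡Y𝟘k) (⊖-closed k 𝟘 k∈H H𝟘)) H𝟘
    where
    open Cosets (proj₁ H-xgroup)
    H𝟘 = proj₁ (proj₁ H-xgroup)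

  FiberInCoset : Subset m → G m → Set
  FiberInCoset L k = ∀ ε → FiberOf k ε → L (ε ⊖ k)

  module _ {L : Subset m} (L-xgroup : IsXGroup X L) where
    open Cosets (proj₁ L-xgroup)

    fiberInCoset⇒fiberClosed : ∀ {g} → FiberInCoset L g → FiberClosed (λ h → L (h ⊖ g))
    fiberInCoset⇒fiberClosed {g} g-fiber δ γ δ∼g γ∼δ with path-lift (sym γ∼δ) g
    ... | ε , _ , Yεγ≡Ygδ = coset-trans γ ε g (xgroup-respects L-xgroup (sym Yεγ≡Ygδ) δ∼g)
                                        (g-fiber ε (source-fiber Yεγ≡Ygδ))

    fiberInCoset⇔fiberClosed : ∀ {g} → FiberInCoset L g ⇔ FiberClosed (λ h → L (h ⊖ g))
    fiberInCoset⇔fiberClosed {g} = mk⇔ fiberInCoset⇒fiberClosed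
      (λ g-closed ε ε∼g → g-closed g ε (coset-refl g) ε∼g)

    fiberInCoset-coset : ∀ {g h} → L (h ⊖ g) → FiberInCoset L g ⇔ FiberInCoset L h
    fiberInCoset-coset {g} {h} h∼g = mk⇔ (move h∼g) (move (coset-sym h g h∼g))
      where
      move : ∀ {g h} → L (h ⊖ g) → FiberInCoset L g → FiberInCoset L h
      move {g} {h} h∼g g-fiber ε ε∼h =
        coset-trans ε g h (fiberInCoset⇒fiberClosed g-fiber h ε h∼g ε∼h) (coset-sym h g h∼g)

  module _ (𝔖 : Section X) where
    open Cosets (proj₁ (L-group 𝔖))

    -- The fiber through g is linked by Y to the source fiber of the basis relation s,
    -- all of whose points lie in L g because s𝔖 = {(L g , L g)}.
    quotientFiber⇒fiberInCoset : ∀ {g} → U 𝔖 g → IsQuotientFiber Y 𝔖 g → FiberInCoset (L 𝔖) g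
    quotientFiber⇒fiberInCoset {g} g∈U (a , b , s⊆U×U , s𝔖) ε ε∼g
      with from (s𝔖 g g g∈U g∈U) (coset-refl g , coset-refl g)
    ... | c , _ , c∼g , _ , Ycd≡Yab with path-lift (sym ε∼g) c
    ...   | c′ , Yεc′≡Ygc , Yc′ε≡Ycg =
      coset-trans ε c′ g (coset-sym c′ ε (xgroup-respects (L-group 𝔖) (sym Yεc′≡Ygc) c∼g))
        (source⊆Lg c′ (trans (source-fiber Yc′ε≡Ycg) (source-fiber Ycd≡Yab)))
      where
      source⊆Lg : ∀ γ → FiberOf a γ → L 𝔖 (γ ⊖ g)
      source⊆Lg γ γ∼a with path-lift (sym γ∼a) b
      ... | δ , Yγδ≡Yab , _ with s⊆U×U γ δ Yγδ≡Yab
      ...   | γ∈U , δ∈U =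
        proj₁ (to (s𝔖 γ δ γ∈U δ∈U) (γ , δ , coset-refl γ , coset-refl δ , Yγδ≡Yab))

    fiberInCoset⇒quotientFiber : ∀ {g} → U 𝔖 g → FiberInCoset (L 𝔖) g → IsQuotientFiber Y 𝔖 g
    fiberInCoset⇒quotientFiber {g} g∈U g-fiber =
      g , g , s⊆U×U , λ h h′ _ _ → mk⇔ (s𝔖⊆ h h′) (⊆s𝔖 h h′)
      where
      s⊆U×U : ∀ c d → Y c d ≡ Y g g → U 𝔖 c × U 𝔖 d
      s⊆U×U c d e with diagonal-colour e
      ... | refl = c∈U , c∈U
        where c∈U = xgroup-fiberClosed (U-group 𝔖) g c g∈U e
      s𝔖⊆ : ∀ h h′ → (Σ (G m) λ c → Σ (G m) λ d → Coset 𝔖 h c × Coset 𝔖 h′ d × Y c d ≡ Y g g) →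
            L 𝔖 (h ⊖ g) × L 𝔖 (h′ ⊖ g)
      s𝔖⊆ h h′ (c , d , c∼h , d∼h′ , e) with diagonal-colour e
      ... | refl = coset-trans h c g (coset-sym c h c∼h) (g-fiber c e)
                 , coset-trans h′ c g (coset-sym c h′ d∼h′) (g-fiber c e)
      ⊆s𝔖 : ∀ h h′ → L 𝔖 (h ⊖ g) × L 𝔖 (h′ ⊖ g) →
            Σ (G m) λ c → Σ (G m) λ d → Coset 𝔖 h c × Coset 𝔖 h′ d × Y c d ≡ Y g g
      ⊆s𝔖 h h′ (h∼g , h′∼g) = g , g , coset-sym h g h∼g , coset-sym h′ g h′∼g , refl

    quotientFiber⇔fiberInCoset : ∀ {g} → U 𝔖 g → IsQuotientFiber Y 𝔖 g ⇔ FiberInCoset (L 𝔖) g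
    quotientFiber⇔fiberInCoset g∈U =
      mk⇔ (quotientFiber⇒fiberInCoset g∈U) (fiberInCoset⇒quotientFiber g∈U)

  fiberInCoset-multiple : ∀ {𝔗 𝔘 : Section X} → IsMultipleOf 𝔘 𝔗 →
                          ∀ {k} → U 𝔗 k → FiberInCoset (L 𝔗) k ⇔ FiberInCoset (L 𝔘) k
  fiberInCoset-multiple {𝔗} (L𝔗≡U𝔗∩L𝔘 , _) {k} k∈U = mk⇔
    (λ k-fiber ε ε∼k → proj₂ (to (L𝔗≡U𝔗∩L𝔘 (ε ⊖ k)) (k-fiber ε ε∼k)))
    (λ k-fiber ε ε∼k → from (L𝔗≡U𝔗∩L𝔘 (ε ⊖ k))
       (⊖-closed ε k (xgroup-fiberClosed (U-group 𝔗) k ε k∈U ε∼k) k∈U , k-fiber ε ε∼k))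
    where open Cosets (proj₁ (U-group 𝔗))

  chainGraph-target∈U : ∀ {𝔖 𝔗 : Section X} (c : Chain 𝔖 𝔗) g h → ChainGraph c g h → U 𝔗 h
  chainGraph-target∈U []         _ _ (_ , h∈U , _)         = h∈U
  chainGraph-target∈U (_ ▸up _)   _ _ (_ , _ , _ , h∈U , _) = h∈U
  chainGraph-target∈U (_ ▸down _) _ _ (_ , _ , h∈U , _ , _) = h∈U

  fiberInCoset-chain : ∀ {𝔖 𝔗 : Section X} (c : Chain 𝔖 𝔗) g h → ChainGraph c g h →
                       FiberInCoset (L 𝔖) g ⇔ FiberInCoset (L 𝔗) h
  fiberInCoset-chain {𝔖} [] _ _ (_ , _ , h∼g) = fiberInCoset-coset (L-group 𝔖) h∼g
  fiberInCoset-chain (_▸up_ {𝔗} {𝔘} c M) g _ (k , g↦k , k∈U , _ , h∼k) =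
    ⇔.trans (fiberInCoset-chain c g k g↦k)
      (⇔.trans (fiberInCoset-multiple {𝔗} {𝔘} M k∈U) (fiberInCoset-coset (L-group 𝔘) h∼k))
  fiberInCoset-chain (_▸down_ {𝔗} {𝔘} c M) g h (k , g↦k , h∈U , _ , k∼h) =
    ⇔.trans (fiberInCoset-chain c g k g↦k)
      (⇔.trans (fiberInCoset-coset (L-group 𝔗) (Cosets.coset-sym (proj₁ (L-group 𝔗)) k h k∼h))
        (⇔.sym (fiberInCoset-multiple {𝔘} {𝔗} M h∈U)))

lemma6p2 : ∀ (m : ℕ) (X : Coloring m) → IsCirculantScheme X →
    (𝔖 : Section X) (g : G m) → U 𝔖 g →
    (x : List (G m)) → 𝟘 ∈ x →
    (Y : Coloring m) → IsPointExtension X x Y →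
    (IsQuotientFiber Y 𝔖 g ⇔ IsUnionOfFibers Y (Coset 𝔖 g))
    × (∀ (𝔗 : Section X) (c : Chain 𝔖 𝔗) (h : G m) → ChainGraph c g h →
         IsQuotientFiber Y 𝔖 g ⇔ IsQuotientFiber Y 𝔗 h)
lemma6p2 _ _ _ 𝔖 g g∈U _ 𝟘∈x _ (Y-cc , X≤Y , points-are-fibers , _) =
  ⇔.trans (quotientFiber⇔fiberInCoset 𝔖 g∈U)
    (⇔.trans (fiberInCoset⇔fiberClosed (L-group 𝔖)) (⇔.sym unionOfFibers⇔fiberClosed)) ,
  λ 𝔗 c h g↦h →
    ⇔.trans (quotientFiber⇔fiberInCoset 𝔖 g∈U)
      (⇔.trans (fiberInCoset-chain c g h g↦h)
        (⇔.sym (quotientFiber⇔fiberInCoset 𝔗 (chainGraph-target∈U c g h g↦h))))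
  where
  open CoherentConfiguration Y-cc
  open PointExtension Y-cc X≤Y (All.lookup points-are-fibers 𝟘∈x)
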